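{- Let $n,k$ be positive integers. Let $G_1$ be a connected graph on $n$ vertices with dissociation number $k$, and let $G_2$ be a connected graph on $n$ vertices with dissociation number $k+1$ having the minimum number of edges among all connected graphs on $n$ vertices with dissociation number $k+1$. Then $e(G_1)\ge e(G_2)$.
   Context: A dissociation set of $G$ is a vertex set inducing a subgraph of maximum degree at most $1$; the dissociation number is the largest size of a dissociation set. $e(G)$ denotes the number of edges. -}

module Defs where

open import Data.Nat using (ℕ; zero; suc; _+_; _≤_; _<ᵇ_)
open import Data.Bool using (Bool; true; false; _∧_; if_then_else_)
open import Data.Fin using (Fin; toℕ)
open import Data.Fin.Subset using (Subset; _∈_; ∣_∣)
open import Data.List using (List; map; allFin)
open import Data.Nat.ListAction using (sum)
open import Data.Vec using (lookup)
open import Data.Product using (Σ; _×_)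
open import Relation.Binary.PropositionalEquality using (_≡_)

record Graph (n : ℕ) : Set where
  field
    adj    : Fin n → Fin n → Bool
    adj-sym    : ∀ i j → adj i j ≡ adj j i
    adj-irrefl : ∀ i → adj i i ≡ false
open Graph public

indicator : Bool → ℕ
indicator b = if b then 1 else 0

edges : ∀ {n} → Graph n → ℕ
edges {n} G =
  sum (map (λ i → sum (map (λ j → indicator ((toℕ i <ᵇ toℕ j) ∧ adj G i j)) (allFin n))) (allFin n))

data Walk {n : ℕ} (G : Graph n) : Fin n → Fin n → Set where
  here : ∀ {i} → Walk G i i
  step : ∀ {i j k} → adj G i j ≡ true → Walk G j k → Walk G i k

Connected : ∀ {n} → Graph n → Set
Connected {n} G = ∀ (i j : Fin n) → Walk G i j

nbrsIn : ∀ {n} → Graph n → Subset n → Fin n → ℕ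
nbrsIn {n} G S v = sum (map (λ j → indicator (lookup S j ∧ adj G v j)) (allFin n))

IsDissociationSet : ∀ {n} → Graph n → Subset n → Set
IsDissociationSet G S = ∀ v → v ∈ S → nbrsIn G S v ≤ 1

DissociationNumber : ∀ {n} → Graph n → ℕ → Set
DissociationNumber {n} G k =
  Σ (Subset n) (λ S → IsDissociationSet G S × ∣ S ∣ ≡ k)
  × (∀ (S : Subset n) → IsDissociationSet G S → ∣ S ∣ ≤ k)

-- Hang the vertices of a connected graph G₁ one at a time onto a root c. Rank the vertices by their
-- distance to c (ties broken by index), so that every vertex v ≠ c has a lower-ranked neighbour,
-- and let hang θ make every vertex v ≠ c of rank ≥ θ a pendant vertex at c, keeping the other
-- edges of G₁. Each hang θ is connected, and counting every edge at its higher-ranked end shows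
-- e(hang θ) ≤ e(G₁). The graph hang 0 is a star with dissociation number n − 1, hang θ is G₁ once θ
-- exceeds all ranks, and hang θ, hang (θ + 1) differ only at the vertex of rank θ, so their
-- dissociation numbers differ by at most one. If k + 1 ≤ n − 1, some hang θ therefore has
-- dissociation number exactly k + 1, and minimality of G₂ gives e(G₂) ≤ e(hang θ) ≤ e(G₁).
-- Otherwise k + 1 = n, so G₂ has maximum degree at most 1 and 2 e(G₂) ≤ n ≤ e(G₁) + 1.

{-# OPTIONS --safe #-}
module Submission where

open import Defs
open import Data.Nat.Base using (ℕ; zero; suc; _+_; _*_; _∸_; _≤_; _<_; _<ᵇ_; z≤n; s≤s; z<s; ⌊_/2⌋)
open import Data.Nat.Properties
  using ( +-0-commutativeMonoid; _≤?_; ≤-refl; ≤-reflexive; ≤-trans; <⇒≤; ≤-antisym; ≤-pred; ≰⇒>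
        ; <-irrefl; <-asym; <-≤-trans; <-cmp; ≮⇒≥; ≤∧≢⇒<; n≤1+n; n≤0⇒n≡0; m≤m+n; m≤n+m; +-mono-≤
        ; +-monoʳ-<; +-comm; +-identityʳ; +-cancelˡ-≡; *-monoˡ-≤; n≡⌊n+n/2⌋; <ᵇ⇒<; <⇒<ᵇ; anyUpTo? )
  renaming (_≟_ to _≟ℕ_)
open import Data.Nat.Induction using (<-wellFounded)
import Data.Nat.ListAction as List
open import Data.Bool.Base using (Bool; true; false; _∧_; if_then_else_; T)
open import Data.Bool.Properties using (T-≡; ∧-zeroʳ)
import Data.Bool.Properties as Bool
open import Data.Empty using (⊥-elim)
open import Data.Fin.Base using (Fin; zero; suc; toℕ; punchIn)
open import Data.Fin.Properties using (_≟_; toℕ<n; toℕ-injective; punchInᵢ≢i; any?; all?)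
open import Data.Fin.Subset using (Subset; _∈_; ∣_∣; ∁; ⁅_⁆; ⊤; inside; outside)
open import Data.Fin.Subset.Properties
  using (_∈?_; anySubset?; ∣p∣≤n; ∣p∣≡n⇒p≡⊤; ∣∁p∣≡n∸∣p∣; ∣⁅x⁆∣≡1; ∈⊤; x∈∁p⇒x∉p; x∉⁅y⁆⇒x≢y)
open import Data.List.Base using (map; allFin; tabulate)
open import Data.List.Properties using (map-tabulate)
open import Data.Product using (∃; _×_; _,_; proj₁; proj₂)
open import Data.Sum using (_⊎_; inj₁; inj₂)
open import Data.Vec.Base using (_∷_; lookup; _[_]≔_)
open import Data.Vec.Properties
  using (lookup⇒[]=; []=⇒lookup; lookup-replicate; []≔-updates; lookup∘update′)
open import Function.Base using (_∘_; id)
open import Function.Bundles using (Equivalence)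
open import Function.Definitions using (Injective)
open import Induction.WellFounded using (Acc; acc)
open import Relation.Binary.Definitions using (tri<; tri≈; tri>)
open import Relation.Binary.PropositionalEquality
open import Relation.Nullary using (Dec; yes; no; ¬_; does; ¬?)
open import Relation.Nullary.Decidable using (_×-dec_; _⊎-dec_; _→-dec_; dec-true; dec-false)
open import Relation.Unary using (Decidable)
open import Algebra.Properties.CommutativeMonoid.Sum +-0-commutativeMonoid
  using (sum; sum-cong-≗; ∑-distrib-+; ∑-comm; sum-remove; sum-replicate-zero)

+-double-injective : ∀ {m n} → m + m ≡ n + n → m ≡ n
+-double-injective {m} {n} e = trans (n≡⌊n+n/2⌋ m) (trans (cong ⌊_/2⌋ e) (sym (n≡⌊n+n/2⌋ n)))

m+m≤1+n⇒m≤n : ∀ {m n} → m + m ≤ suc n → m ≤ n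
m+m≤1+n⇒m≤n {zero}  _               = z≤n
m+m≤1+n⇒m≤n {suc m} (s≤s m+1+m≤n) = ≤-trans (m≤n+m (suc m) m) m+1+m≤n

∧-true : ∀ {a b} → a ∧ b ≡ true → a ≡ true × b ≡ true
∧-true {true} b≡true = refl , b≡true

<ᵇ-true⇒< : ∀ m n → (m <ᵇ n) ≡ true → m < n
<ᵇ-true⇒< m n e = <ᵇ⇒< m n (Equivalence.from T-≡ e)

<⇒<ᵇ-true : ∀ {m n} → m < n → (m <ᵇ n) ≡ true
<⇒<ᵇ-true m<n = Equivalence.to T-≡ (<⇒<ᵇ m<n)

indicator-<ᵇ-split : ∀ {x y} → x ≢ y → ∀ b →
  indicator ((x <ᵇ y) ∧ b) + indicator ((y <ᵇ x) ∧ b) ≡ indicator b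
indicator-<ᵇ-split {x} {y} x≢y b with x <ᵇ y in x<y | y <ᵇ x in y<x
... | true  | true  = ⊥-elim (<-asym (<ᵇ-true⇒< x y x<y) (<ᵇ-true⇒< y x y<x))
... | true  | false = +-identityʳ _
... | false | true  = refl
... | false | false = ⊥-elim (x≢y (≤-antisym (not-< y<x) (not-< x<y)))
  where
  not-< : ∀ {m n} → (m <ᵇ n) ≡ false → n ≤ m
  not-< m≮n = ≮⇒≥ (λ m<n → subst T m≮n (<⇒<ᵇ m<n))

crossing : ∀ {P : ℕ → Set} → Decidable P → P 0 → ∀ K → ¬ P K → ∃ λ θ → P θ × ¬ P (suc θ)
crossing P? P0 zero    ¬PK = ⊥-elim (¬PK P0)
crossing P? P0 (suc K) ¬P1+K with P? K
... | yes PK = K , PK , ¬P1+K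
... | no ¬PK = crossing P? P0 K ¬PK

least-witness : ∀ {P : ℕ → Set} → Decidable P → ∀ {m} → P m → ∃ λ d → P d × (∀ {m} → P m → d ≤ m)
least-witness {P} P? {m} Pm = go m (<-wellFounded m) Pm
  where
  go : ∀ m → Acc _<_ m → P m → ∃ λ d → P d × (∀ {m} → P m → d ≤ m)
  go m (acc smaller) Pm with anyUpTo? P? m
  ... | yes (m′ , m′<m , Pm′) = go m′ (smaller m′<m) Pm′
  ... | no none               = m , Pm , λ Pm′ → ≮⇒≥ (λ m′<m → none (_ , m′<m , Pm′))

sum-allFin : ∀ {n} (f : Fin n → ℕ) → List.sum (map f (allFin n)) ≡ sum f
sum-allFin {n} f = trans (cong List.sum (map-tabulate id f)) (sum-tabulate f)
  where
  sum-tabulate : ∀ {n} (f : Fin n → ℕ) → List.sum (tabulate f) ≡ sum f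
  sum-tabulate {zero}  f = refl
  sum-tabulate {suc n} f = cong (f zero +_) (sum-tabulate (f ∘ suc))

sum-mono-≤ : ∀ {n} {f g : Fin n → ℕ} → (∀ i → f i ≤ g i) → sum f ≤ sum g
sum-mono-≤ {zero}  f≤g = z≤n
sum-mono-≤ {suc n} f≤g = +-mono-≤ (f≤g zero) (sum-mono-≤ (f≤g ∘ suc))

≤-sum : ∀ {n} (f : Fin n → ℕ) i → f i ≤ sum f
≤-sum {suc n} f i = subst (f i ≤_) (sym (sum-remove {i = i} f)) (m≤m+n (f i) _)

sum-ones : ∀ n → sum {n} (λ _ → 1) ≡ n
sum-ones zero    = refl
sum-ones (suc n) = cong suc (sum-ones n)

sum-≤1⇒≤n : ∀ {n} {f : Fin n → ℕ} → (∀ i → f i ≤ 1) → sum f ≤ n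
sum-≤1⇒≤n {n} f≤1 = ≤-trans (sum-mono-≤ f≤1) (≤-reflexive (sum-ones n))

n≤1+sum : ∀ {n} (f : Fin n → ℕ) c → (∀ i → i ≢ c → 1 ≤ f i) → n ≤ suc (sum f)
n≤1+sum {suc n} f c 1≤f = s≤s (begin
  n                           ≡⟨ sum-ones n ⟨
  sum {n} (λ _ → 1)           ≤⟨ sum-mono-≤ (λ j → 1≤f (punchIn c j) (punchInᵢ≢i c j)) ⟩
  sum (f ∘ punchIn c)         ≤⟨ m≤n+m _ (f c) ⟩
  f c + sum (f ∘ punchIn c)   ≡⟨ sum-remove {i = c} f ⟨
  sum f                       ∎)
  where open Data.Nat.Properties.≤-Reasoning

indicator≤1 : ∀ b → indicator b ≤ 1
indicator≤1 true  = ≤-refl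
indicator≤1 false = z≤n

indicator-mono : ∀ {a b} → (a ≡ true → b ≡ true) → indicator a ≤ indicator b
indicator-mono {false} a⇒b = z≤n
indicator-mono {true}  a⇒b rewrite a⇒b refl = ≤-refl

sum-indicator-mono : ∀ {n} {a b : Fin n → Bool} →
  (∀ i → a i ≡ true → b i ≡ true) → sum (indicator ∘ a) ≤ sum (indicator ∘ b)
sum-indicator-mono a⇒b = sum-mono-≤ (λ i → indicator-mono (a⇒b i))

1≤sum-indicator : ∀ {n} (a : Fin n → Bool) {i} → a i ≡ true → 1 ≤ sum (indicator ∘ a)
1≤sum-indicator a {i} aᵢ =
  subst (_≤ sum (indicator ∘ a)) (cong indicator aᵢ) (≤-sum (indicator ∘ a) i)

sum-indicator≤1 : ∀ {n} {a : Fin n → Bool} c → (∀ i → a i ≡ true → i ≡ c) → sum (indicator ∘ a) ≤ 1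
sum-indicator≤1 {suc n} {a} c only-c = begin
  sum (indicator ∘ a)                              ≡⟨ sum-remove {i = c} (indicator ∘ a) ⟩
  indicator (a c) + sum (indicator ∘ a ∘ punchIn c) ≡⟨ cong (indicator (a c) +_) rest≡0 ⟩
  indicator (a c) + 0                              ≡⟨ +-identityʳ _ ⟩
  indicator (a c)                                  ≤⟨ indicator≤1 (a c) ⟩
  1                                                ∎
  where
  open Data.Nat.Properties.≤-Reasoning
  off-c : ∀ j → indicator (a (punchIn c j)) ≡ 0
  off-c j with a (punchIn c j) in aⱼ
  ... | true  = ⊥-elim (punchInᵢ≢i c j (only-c _ aⱼ))
  ... | false = refl
  rest≡0 : sum (indicator ∘ a ∘ punchIn c) ≡ 0
  rest≡0 = trans (sum-cong-≗ off-c) (sum-replicate-zero n)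

-- Counting edges along an injective ranking

degree : ∀ {n} → Graph n → Fin n → ℕ
degree G i = sum (λ j → indicator (adj G i j))

lowerDegree : ∀ {n} → Graph n → (Fin n → ℕ) → Fin n → ℕ
lowerDegree G κ i = sum (λ j → indicator ((κ j <ᵇ κ i) ∧ adj G i j))

upperDegree : ∀ {n} → Graph n → (Fin n → ℕ) → Fin n → ℕ
upperDegree G κ i = sum (λ j → indicator ((κ i <ᵇ κ j) ∧ adj G i j))

module _ {n : ℕ} (G : Graph n) where

  edges≡∑upperDegree : edges G ≡ sum (upperDegree G toℕ)
  edges≡∑upperDegree =
    trans (sum-allFin (λ i → List.sum (map (upper i) (allFin n)))) (sum-cong-≗ (sum-allFin ∘ upper))
    where
    upper : Fin n → Fin n → ℕ
    upper i j = indicator ((toℕ i <ᵇ toℕ j) ∧ adj G i j)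

  ∑upperDegree≡∑lowerDegree : ∀ κ → sum (upperDegree G κ) ≡ sum (lowerDegree G κ)
  ∑upperDegree≡∑lowerDegree κ =
    trans (∑-comm (λ i j → indicator ((κ i <ᵇ κ j) ∧ adj G i j))) (sum-cong-≗ λ j → sum-cong-≗ λ i →
    cong (λ b → indicator ((κ i <ᵇ κ j) ∧ b)) (adj-sym G i j))

  upperDegree+lowerDegree : ∀ {κ} → Injective _≡_ _≡_ κ →
    ∀ i → upperDegree G κ i + lowerDegree G κ i ≡ degree G i
  upperDegree+lowerDegree {κ} κ-inj i =
    trans (sym (∑-distrib-+ (λ j → indicator ((κ i <ᵇ κ j) ∧ adj G i j)) _)) (sum-cong-≗ split)
    where
    split : ∀ j → indicator ((κ i <ᵇ κ j) ∧ adj G i j) + indicator ((κ j <ᵇ κ i) ∧ adj G i j)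
                ≡ indicator (adj G i j)
    split j with i ≟ j
    ... | yes refl rewrite adj-irrefl G i | ∧-zeroʳ (κ i <ᵇ κ i) = refl
    ... | no i≢j   = indicator-<ᵇ-split (i≢j ∘ κ-inj) (adj G i j)

  ∑lowerDegree-handshake : ∀ {κ} → Injective _≡_ _≡_ κ →
    sum (lowerDegree G κ) + sum (lowerDegree G κ) ≡ sum (degree G)
  ∑lowerDegree-handshake {κ} κ-inj = begin
    L + L                                             ≡⟨ cong (_+ L) (∑upperDegree≡∑lowerDegree κ) ⟨
    sum (upperDegree G κ) + L                         ≡⟨ ∑-distrib-+ (upperDegree G κ) (lowerDegree G κ) ⟨
    sum (λ i → upperDegree G κ i + lowerDegree G κ i) ≡⟨ sum-cong-≗ (upperDegree+lowerDegree κ-inj) ⟩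
    sum (degree G)                                    ∎
    where
    open ≡-Reasoning
    L : ℕ
    L = sum (lowerDegree G κ)

  handshake : edges G + edges G ≡ sum (degree G)
  handshake rewrite edges≡∑upperDegree | ∑upperDegree≡∑lowerDegree toℕ =
    ∑lowerDegree-handshake toℕ-injective

  edges≡∑lowerDegree : ∀ {κ} → Injective _≡_ _≡_ κ → edges G ≡ sum (lowerDegree G κ)
  edges≡∑lowerDegree κ-inj =
    +-double-injective (trans handshake (sym (∑lowerDegree-handshake κ-inj)))

-- Dissociation sets

∣p∣≤1+∣p[x]≔outside∣ : ∀ {n} (p : Subset n) x → ∣ p ∣ ≤ suc ∣ p [ x ]≔ outside ∣
∣p∣≤1+∣p[x]≔outside∣ (inside  ∷ p) zero    = ≤-refl
∣p∣≤1+∣p[x]≔outside∣ (outside ∷ p) zero    = n≤1+n ∣ p ∣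
∣p∣≤1+∣p[x]≔outside∣ (inside  ∷ p) (suc x) = s≤s (∣p∣≤1+∣p[x]≔outside∣ p x)
∣p∣≤1+∣p[x]≔outside∣ (outside ∷ p) (suc x) = ∣p∣≤1+∣p[x]≔outside∣ p x

module _ {n : ℕ} where

  nbrsIn≡sum : ∀ (G : Graph n) S v → nbrsIn G S v ≡ sum (λ j → indicator (lookup S j ∧ adj G v j))
  nbrsIn≡sum G S v = sum-allFin (λ j → indicator (lookup S j ∧ adj G v j))

  nbrsIn-mono : ∀ (G H : Graph n) S T v →
    (∀ j → j ∈ S → adj G v j ≡ true → j ∈ T × adj H v j ≡ true) → nbrsIn G S v ≤ nbrsIn H T v
  nbrsIn-mono G H S T v nbrs⊆ =
    subst₂ _≤_ (sym (nbrsIn≡sum G S v)) (sym (nbrsIn≡sum H T v)) (sum-indicator-mono nbr⇒nbr)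
    where
    nbr⇒nbr : ∀ j → lookup S j ∧ adj G v j ≡ true → lookup T j ∧ adj H v j ≡ true
    nbr⇒nbr j e with ∧-true e
    ... | j∈S , vj with nbrs⊆ j (lookup⇒[]= j S j∈S) vj
    ...   | j∈T , vj′ = cong₂ _∧_ ([]=⇒lookup j∈T) vj′

  AgreeAwayFrom : Fin n → Graph n → Graph n → Set
  AgreeAwayFrom v G H = ∀ x y → x ≢ v → y ≢ v → adj G x y ≡ adj H x y

  DissociationAtLeast : Graph n → ℕ → Set
  DissociationAtLeast G m = ∃ λ (S : Subset n) → IsDissociationSet G S × m ≤ ∣ S ∣

  isDissociationSet? : ∀ (G : Graph n) S → Dec (IsDissociationSet G S)
  isDissociationSet? G S = all? (λ v → (v ∈? S) →-dec (nbrsIn G S v ≤? 1))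

  dissociationAtLeast? : ∀ (G : Graph n) m → Dec (DissociationAtLeast G m)
  dissociationAtLeast? G m = anySubset? (λ S → isDissociationSet? G S ×-dec (m ≤? ∣ S ∣))

  isDissociationSet-cong : ∀ G H {S} → (∀ x y → adj G x y ≡ adj H x y) →
    IsDissociationSet G S → IsDissociationSet H S
  isDissociationSet-cong G H {S} G≗H S-diss v v∈S =
    ≤-trans (nbrsIn-mono H G S S v (λ j j∈S vj → j∈S , trans (G≗H v j) vj)) (S-diss v v∈S)

  isDissociationSet-remove : ∀ G H {v S} → AgreeAwayFrom v G H →
    IsDissociationSet H S → IsDissociationSet G (S [ v ]≔ outside)
  isDissociationSet-remove G H {v} {S} G≈H S-diss x x∈S-v =
    ≤-trans (nbrsIn-mono G H (S [ v ]≔ outside) S x nbr⇒nbr) (S-diss x (∈S x∈S-v))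
    where
    ≢v : ∀ {y} → y ∈ S [ v ]≔ outside → y ≢ v
    ≢v y∈S-v refl with () ← trans (sym ([]=⇒lookup y∈S-v)) ([]=⇒lookup ([]≔-updates S v))
    ∈S : ∀ {y} → y ∈ S [ v ]≔ outside → y ∈ S
    ∈S {y} y∈S-v =
      lookup⇒[]= y S (trans (sym (lookup∘update′ (≢v y∈S-v) S outside)) ([]=⇒lookup y∈S-v))
    nbr⇒nbr : ∀ j → j ∈ S [ v ]≔ outside → adj G x j ≡ true → j ∈ S × adj H x j ≡ true
    nbr⇒nbr j j∈S-v xj = ∈S j∈S-v , trans (sym (G≈H x j (≢v x∈S-v) (≢v j∈S-v))) xj

  dissociationAtLeast-remove : ∀ G H {v m} → AgreeAwayFrom v G H →
    DissociationAtLeast H (suc m) → DissociationAtLeast G m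
  dissociationAtLeast-remove G H {v} G≈H (S , S-diss , m<∣S∣) =
    S [ v ]≔ outside , isDissociationSet-remove G H G≈H S-diss ,
    ≤-pred (≤-trans m<∣S∣ (∣p∣≤1+∣p[x]≔outside∣ S v))

  dissociationNumber-exact : ∀ G {m} → DissociationAtLeast G m → ¬ DissociationAtLeast G (suc m) →
    DissociationNumber G m
  dissociationNumber-exact G {m} (S , S-diss , m≤∣S∣) ¬larger =
    (S , S-diss , ≤-antisym (bound S S-diss) m≤∣S∣) , bound
    where
    bound : ∀ T → IsDissociationSet G T → ∣ T ∣ ≤ m
    bound T T-diss = ≮⇒≥ (λ m<∣T∣ → ¬larger (T , T-diss , m<∣T∣))

-- Rooted rankings of connected graphs

module _ {n : ℕ} {G : Graph n} where

  _◅◅_ : ∀ {i j k} → Walk G i j → Walk G j k → Walk G i k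
  here       ◅◅ w′ = w′
  step ij w  ◅◅ w′ = step ij (w ◅◅ w′)

  reverse : ∀ {i j} → Walk G i j → Walk G j i
  reverse here                   = here
  reverse (step {i} {j} ij w) = reverse w ◅◅ step (trans (adj-sym G j i) ij) here

  walksToRoot⇒connected : ∀ {c} → (∀ v → Walk G v c) → Connected G
  walksToRoot⇒connected toRoot i j = toRoot i ◅◅ reverse (toRoot j)

record RootedRanking {n : ℕ} (G : Graph n) (c : Fin n) : Set where
  field
    rank           : Fin n → ℕ
    rank-injective : Injective _≡_ _≡_ rank
    root-lowest    : ∀ v → v ≢ c → rank c < rank v
    parent         : ∀ v → v ≢ c → ∃ λ u → adj G v u ≡ true × rank u < rank v

module _ {n : ℕ} (G : Graph n) (c : Fin n) where

  ReachesRootWithin : ℕ → Fin n → Set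
  ReachesRootWithin zero    v = v ≡ c
  ReachesRootWithin (suc m) v = v ≡ c ⊎ ∃ λ u → adj G v u ≡ true × ReachesRootWithin m u

  reachesRootWithin? : ∀ m v → Dec (ReachesRootWithin m v)
  reachesRootWithin? zero    v = v ≟ c
  reachesRootWithin? (suc m) v =
    v ≟ c ⊎-dec any? (λ u → adj G v u Bool.≟ true ×-dec reachesRootWithin? m u)

  walk⇒reachesRootWithin : ∀ {v} → Walk G v c → ∃ λ m → ReachesRootWithin m v
  walk⇒reachesRootWithin here          = 0 , refl
  walk⇒reachesRootWithin (step vu w) with walk⇒reachesRootWithin w
  ... | m , reaches = suc m , inj₂ (_ , vu , reaches)

  module _ (conn : Connected G) where

    depth-spec : ∀ v → ∃ λ d → ReachesRootWithin d v × (∀ {m} → ReachesRootWithin m v → d ≤ m)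
    depth-spec v =
      least-witness (λ m → reachesRootWithin? m v) (proj₂ (walk⇒reachesRootWithin (conn v c)))

    depth : Fin n → ℕ
    depth v = proj₁ (depth-spec v)

    depth-reaches : ∀ v → ReachesRootWithin (depth v) v
    depth-reaches v = proj₁ (proj₂ (depth-spec v))

    depth-least : ∀ {m} v → ReachesRootWithin m v → depth v ≤ m
    depth-least v = proj₂ (proj₂ (depth-spec v))

    depth-root : depth c ≡ 0
    depth-root = n≤0⇒n≡0 (depth-least c refl)

    parent-depth : ∀ {m v} → ReachesRootWithin m v → v ≢ c → ∃ λ u → adj G v u ≡ true × depth u < m
    parent-depth {zero}  v≡c                 v≢c = ⊥-elim (v≢c v≡c)
    parent-depth {suc m} (inj₁ v≡c)          v≢c = ⊥-elim (v≢c v≡c)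
    parent-depth {suc m} (inj₂ (u , vu , r)) _   = u , vu , s≤s (depth-least u r)

    depth-pos : ∀ v → v ≢ c → 0 < depth v
    depth-pos v v≢c = let _ , _ , du<dv = parent-depth (depth-reaches v) v≢c in <-≤-trans z<s du<dv

    depthRank : Fin n → ℕ
    depthRank v = depth v * n + toℕ v

    depthRank-mono : ∀ {u v} → depth u < depth v → depthRank u < depthRank v
    depthRank-mono {u} {v} du<dv = begin-strict
      depth u * n + toℕ u   <⟨ +-monoʳ-< (depth u * n) (toℕ<n u) ⟩
      depth u * n + n       ≡⟨ +-comm (depth u * n) n ⟩
      suc (depth u) * n     ≤⟨ *-monoˡ-≤ n du<dv ⟩
      depth v * n           ≤⟨ m≤m+n (depth v * n) (toℕ v) ⟩
      depth v * n + toℕ v   ∎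
      where open Data.Nat.Properties.≤-Reasoning

    depthRank-injective : Injective _≡_ _≡_ depthRank
    depthRank-injective {u} {v} ru≡rv with <-cmp (depth u) (depth v)
    ... | tri< du<dv _ _ = ⊥-elim (<-irrefl ru≡rv (depthRank-mono du<dv))
    ... | tri> _ _ dv<du = ⊥-elim (<-irrefl (sym ru≡rv) (depthRank-mono dv<du))
    ... | tri≈ _ du≡dv _ rewrite du≡dv = toℕ-injective (+-cancelˡ-≡ (depth v * n) _ _ ru≡rv)

  connected⇒rootedRanking : Connected G → RootedRanking G c
  connected⇒rootedRanking conn = record
    { rank           = depthRank conn
    ; rank-injective = depthRank-injective conn
    ; root-lowest    = λ v v≢c →
        depthRank-mono conn (subst (_< depth conn v) (sym (depth-root conn)) (depth-pos conn v v≢c))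
    ; parent         = λ v v≢c →
        let u , vu , du<dv = parent-depth conn (depth-reaches conn v) v≢c
        in  u , vu , depthRank-mono conn du<dv
    }

module _ {n : ℕ} {G : Graph n} {c : Fin n} (R : RootedRanking G c) where
  open RootedRanking R

  lowerDegree≥1 : ∀ v → v ≢ c → 1 ≤ lowerDegree G rank v
  lowerDegree≥1 v v≢c with parent v v≢c
  ... | u , vu , ru<rv =
    1≤sum-indicator (λ j → (rank j <ᵇ rank v) ∧ adj G v j) (cong₂ _∧_ (<⇒<ᵇ-true ru<rv) vu)

  rootedRanking⇒n≤1+edges : n ≤ suc (edges G)
  rootedRanking⇒n≤1+edges = subst (λ e → n ≤ suc e) (sym (edges≡∑lowerDegree G rank-injective))
                                  (n≤1+sum (lowerDegree G rank) c lowerDegree≥1)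

connected⇒n≤1+edges : ∀ {n} {G : Graph n} → Connected G → n ≤ suc (edges G)
connected⇒n≤1+edges {zero}      _    = z≤n
connected⇒n≤1+edges {suc n} {G} conn = rootedRanking⇒n≤1+edges (connected⇒rootedRanking G zero conn)

-- Hanging high-ranked vertices on the root

module Hang {n : ℕ} {G : Graph n} {c : Fin n} (R : RootedRanking G c) where
  open RootedRanking R

  isRoot : Fin n → Bool
  isRoot v = does (v ≟ c)

  Hung : ℕ → Fin n → Set
  Hung θ v = v ≢ c × θ ≤ rank v

  hung? : ∀ θ v → Dec (Hung θ v)
  hung? θ v = ¬? (v ≟ c) ×-dec θ ≤? rank v

  -- Parametrised by the two hung-flags so that hangAdj can be rewritten along equations for
  -- does (hung? θ x), which a with on hung? θ x cannot reach inside hangAdj.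
  pendantAdj : Bool → Bool → Fin n → Fin n → Bool
  pendantAdj hungX hungY x y = if hungX then isRoot y else if hungY then isRoot x else adj G x y

  hangAdj : ℕ → Fin n → Fin n → Bool
  hangAdj θ x y = pendantAdj (does (hung? θ x)) (does (hung? θ y)) x y

  hangAdj-hung : ∀ {θ x} → Hung θ x → ∀ y → hangAdj θ x y ≡ isRoot y
  hangAdj-hung {θ} {x} hx y = cong (λ b → pendantAdj b _ x y) (dec-true (hung? θ x) hx)

  hangAdj-toHung : ∀ {θ x y} → ¬ Hung θ x → Hung θ y → hangAdj θ x y ≡ isRoot x
  hangAdj-toHung {θ} {x} {y} ¬hx hy =
    cong₂ (λ a b → pendantAdj a b x y) (dec-false (hung? θ x) ¬hx) (dec-true (hung? θ y) hy)

  hangAdj-unhung : ∀ {θ x y} → ¬ Hung θ x → ¬ Hung θ y → hangAdj θ x y ≡ adj G x y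
  hangAdj-unhung {θ} {x} {y} ¬hx ¬hy =
    cong₂ (λ a b → pendantAdj a b x y) (dec-false (hung? θ x) ¬hx) (dec-false (hung? θ y) ¬hy)

  isRoot-≢ : ∀ {v} → v ≢ c → isRoot v ≡ false
  isRoot-≢ {v} = dec-false (v ≟ c)

  isRoot⇒≡ : ∀ {v} → isRoot v ≡ true → v ≡ c
  isRoot⇒≡ {v} e with v ≟ c
  ... | yes v≡c = v≡c

  hangAdj-sym : ∀ θ x y → hangAdj θ x y ≡ hangAdj θ y x
  hangAdj-sym θ x y with hung? θ x | hung? θ y
  ... | yes hx | yes hy = begin
    hangAdj θ x y  ≡⟨ hangAdj-hung hx y ⟩
    isRoot y       ≡⟨ isRoot-≢ (proj₁ hy) ⟩
    false          ≡⟨ isRoot-≢ (proj₁ hx) ⟨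
    isRoot x       ≡⟨ hangAdj-hung hy x ⟨
    hangAdj θ y x  ∎
    where open ≡-Reasoning
  ... | yes hx | no ¬hy = trans (hangAdj-hung hx y) (sym (hangAdj-toHung ¬hy hx))
  ... | no ¬hx | yes hy = trans (hangAdj-toHung ¬hx hy) (sym (hangAdj-hung hy x))
  ... | no ¬hx | no ¬hy =
    trans (hangAdj-unhung ¬hx ¬hy) (trans (adj-sym G x y) (sym (hangAdj-unhung ¬hy ¬hx)))

  hangAdj-irrefl : ∀ θ x → hangAdj θ x x ≡ false
  hangAdj-irrefl θ x with hung? θ x
  ... | yes hx  = trans (hangAdj-hung hx x) (isRoot-≢ (proj₁ hx))
  ... | no ¬hx  = trans (hangAdj-unhung ¬hx ¬hx) (adj-irrefl G x)

  hang : ℕ → Graph n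
  hang θ = record { adj = hangAdj θ ; adj-sym = hangAdj-sym θ ; adj-irrefl = hangAdj-irrefl θ }

  hung-adj⇒root : ∀ {θ x y} → Hung θ x → hangAdj θ x y ≡ true → y ≡ c
  hung-adj⇒root {y = y} hx xy = isRoot⇒≡ (trans (sym (hangAdj-hung hx y)) xy)

  hang-walkToRoot : ∀ θ v → Walk (hang θ) v c
  hang-walkToRoot θ v = go v (<-wellFounded (rank v))
    where
    go : ∀ v → Acc _<_ (rank v) → Walk (hang θ) v c
    go v (acc smaller) with v ≟ c | hung? θ v
    ... | yes refl | _  = here
    ... | no _     | yes hv = step (trans (hangAdj-hung hv c) (dec-true (c ≟ c) refl)) here
    ... | no v≢c   | no ¬hv with parent v v≢c
    ...   | u , vu , ru<rv = step (trans (hangAdj-unhung ¬hv ¬hu) vu) (go u (smaller ru<rv))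
      where
      ¬hu : ¬ Hung θ u
      ¬hu (_ , θ≤ru) = ¬hv (v≢c , ≤-trans θ≤ru (<⇒≤ ru<rv))

  hang-connected : ∀ θ → Connected (hang θ)
  hang-connected θ = walksToRoot⇒connected (hang-walkToRoot θ)

  lowerDegree-hang≤ : ∀ θ i → lowerDegree (hang θ) rank i ≤ lowerDegree G rank i
  lowerDegree-hang≤ θ i with hung? θ i
  ... | yes hᵢ = ≤-trans (sum-indicator≤1 c (λ j e → hung-adj⇒root hᵢ (proj₂ (∧-true e))))
                         (lowerDegree≥1 R i (proj₁ hᵢ))
  ... | no ¬hᵢ = sum-indicator-mono lower⇒lower
    where
    lower⇒lower : ∀ j → (rank j <ᵇ rank i) ∧ hangAdj θ i j ≡ true →
                        (rank j <ᵇ rank i) ∧ adj G i j ≡ true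
    lower⇒lower j e with ∧-true e | hung? θ j
    ... | rj<ri , ij | yes hⱼ = ⊥-elim (<-asym (<ᵇ-true⇒< _ _ rj<ri) ri<rj)
      where
      i≡c : i ≡ c
      i≡c = isRoot⇒≡ (trans (sym (hangAdj-toHung ¬hᵢ hⱼ)) ij)
      ri<rj : rank i < rank j
      ri<rj = subst (λ r → rank r < rank j) (sym i≡c) (root-lowest j (proj₁ hⱼ))
    ... | rj<ri , ij | no ¬hⱼ = cong₂ _∧_ rj<ri (trans (sym (hangAdj-unhung ¬hᵢ ¬hⱼ)) ij)

  edges-hang≤ : ∀ θ → edges (hang θ) ≤ edges G
  edges-hang≤ θ = subst₂ _≤_ (sym (edges≡∑lowerDegree (hang θ) rank-injective))
                             (sym (edges≡∑lowerDegree G rank-injective))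
                             (sum-mono-≤ (lowerDegree-hang≤ θ))

  hung-suc : ∀ θ x → rank x ≢ θ → does (hung? (suc θ) x) ≡ does (hung? θ x)
  hung-suc θ x rx≢θ with hung? θ x
  ... | yes h@(x≢c , θ≤rx) =
    trans (dec-true (hung? (suc θ) x) (x≢c , ≤∧≢⇒< θ≤rx (rx≢θ ∘ sym)))
          (sym (dec-true (hung? θ x) h))
  ... | no ¬h =
    trans (dec-false (hung? (suc θ) x) (λ (x≢c , θ<rx) → ¬h (x≢c , <⇒≤ θ<rx)))
          (sym (dec-false (hung? θ x) ¬h))

  hang-suc-agree : ∀ θ v → (∀ {x} → x ≢ v → rank x ≢ θ) → AgreeAwayFrom v (hang (suc θ)) (hang θ)
  hang-suc-agree θ v rank≢θ x y x≢v y≢v =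
    cong₂ (λ a b → pendantAdj a b x y) (hung-suc θ x (rank≢θ x≢v)) (hung-suc θ y (rank≢θ y≢v))

  hang-suc-agree-somewhere : ∀ θ → ∃ λ v → AgreeAwayFrom v (hang (suc θ)) (hang θ)
  hang-suc-agree-somewhere θ with any? (λ v → rank v ≟ℕ θ)
  ... | yes (v , rv≡θ) =
    v , hang-suc-agree θ v (λ x≢v rx≡θ → x≢v (rank-injective (trans rx≡θ (sym rv≡θ))))
  ... | no ¬rank≡θ =
    c , hang-suc-agree θ c (λ {x} _ rx≡θ → ¬rank≡θ (x , rx≡θ))

  hangAdj-beyond : ∀ θ → (∀ v → rank v < θ) → ∀ x y → hangAdj θ x y ≡ adj G x y
  hangAdj-beyond θ rank<θ x y = hangAdj-unhung (unhung x) (unhung y)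
    where
    unhung : ∀ v → ¬ Hung θ v
    unhung v (_ , θ≤rv) = <-irrefl refl (<-≤-trans (rank<θ v) θ≤rv)

  hang-0-isDissociationSet : IsDissociationSet (hang 0) (∁ ⁅ c ⁆)
  hang-0-isDissociationSet v v∈S = subst (_≤ 1) (sym (nbrsIn≡sum (hang 0) (∁ ⁅ c ⁆) v))
    (sum-indicator≤1 c (λ j e → hung-adj⇒root (v≢c , z≤n) (proj₂ (∧-true e))))
    where
    v≢c : v ≢ c
    v≢c = x∉⁅y⁆⇒x≢y (x∈∁p⇒x∉p v∈S)

  hang-0-dissociationAtLeast : ∀ {m} → m ≤ n ∸ 1 → DissociationAtLeast (hang 0) m
  hang-0-dissociationAtLeast m≤n-1 =
    ∁ ⁅ c ⁆ , hang-0-isDissociationSet , ≤-trans m≤n-1 (≤-reflexive (sym ∣∁⁅c⁆∣≡n-1))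
    where
    ∣∁⁅c⁆∣≡n-1 : ∣ ∁ ⁅ c ⁆ ∣ ≡ n ∸ 1
    ∣∁⁅c⁆∣≡n-1 = trans (∣∁p∣≡n∸∣p∣ ⁅ c ⁆) (cong (n ∸_) (∣⁅x⁆∣≡1 c))

dissociationNumber-interpolation : ∀ {n k m} {G : Graph (suc n)} →
  Connected G → DissociationNumber G k → k < m → m ≤ n →
  ∃ λ H → Connected H × DissociationNumber H m × edges H ≤ edges G
dissociationNumber-interpolation {m = m} {G} conn (_ , maximal) k<m m≤n =
  let θ , ≥m , ¬next≥m = crossing (λ θ → dissociationAtLeast? (hang θ) m)
                                  (hang-0-dissociationAtLeast m≤n) K ¬top≥m
      v , agree        = hang-suc-agree-somewhere θ
      ¬≥1+m            = ¬next≥m ∘ dissociationAtLeast-remove (hang (suc θ)) (hang θ) agree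
  in  hang θ , hang-connected θ , dissociationNumber-exact (hang θ) ≥m ¬≥1+m , edges-hang≤ θ
  where
  R : RootedRanking G zero
  R = connected⇒rootedRanking G zero conn
  open RootedRanking R
  open Hang R
  K : ℕ
  K = suc (sum rank)
  ¬top≥m : ¬ DissociationAtLeast (hang K) m
  ¬top≥m (S , S-diss , m≤∣S∣) = <-irrefl refl (<-≤-trans k<m (≤-trans m≤∣S∣ (maximal S G-diss)))
    where
    G-diss : IsDissociationSet G S
    G-diss =
      isDissociationSet-cong (hang K) G (hangAdj-beyond K (λ v → s≤s (≤-sum rank v))) S-diss

fullDissociation⇒edges≤ : ∀ {n} (G H : Graph n) → IsDissociationSet G ⊤ → Connected H →
  edges G ≤ edges H
fullDissociation⇒edges≤ {n} G H ⊤-diss conn = m+m≤1+n⇒m≤n (begin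
  edges G + edges G  ≡⟨ handshake G ⟩
  sum (degree G)     ≤⟨ sum-≤1⇒≤n degree≤1 ⟩
  n                  ≤⟨ connected⇒n≤1+edges conn ⟩
  suc (edges H)      ∎)
  where
  open Data.Nat.Properties.≤-Reasoning
  degree≤1 : ∀ v → degree G v ≤ 1
  degree≤1 v = subst (_≤ 1) nbrsIn≡degree (⊤-diss v ∈⊤)
    where
    nbrsIn≡degree : nbrsIn G ⊤ v ≡ degree G v
    nbrsIn≡degree = trans (nbrsIn≡sum G ⊤ v)
      (sum-cong-≗ λ j → cong (λ b → indicator (b ∧ adj G v j)) (lookup-replicate j inside))

lemma4p2 : ∀ (n k : ℕ) → 1 ≤ n → 1 ≤ k
    → (G₁ G₂ : Graph n)
    → Connected G₁ → DissociationNumber G₁ k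
    → Connected G₂ → DissociationNumber G₂ (suc k)
    → (∀ (H : Graph n) → Connected H → DissociationNumber H (suc k) → edges G₂ ≤ edges H)
    → edges G₂ ≤ edges G₁
lemma4p2 zero    _ ()
lemma4p2 (suc n) k _ _ G₁ G₂ conn₁ ψ₁ _ ((S₂ , S₂-diss , ∣S₂∣≡1+k) , _) minimal with suc k ≤? n
... | yes 1+k≤n =
  let H , connH , ψH , H≤G₁ = dissociationNumber-interpolation conn₁ ψ₁ ≤-refl 1+k≤n
  in  ≤-trans (minimal H connH ψH) H≤G₁
... | no 1+k≰n =
  fullDissociation⇒edges≤ G₂ G₁ (subst (IsDissociationSet G₂) S₂≡⊤ S₂-diss) conn₁
  where
  S₂≡⊤ : S₂ ≡ ⊤
  S₂≡⊤ = ∣p∣≡n⇒p≡⊤ (trans ∣S₂∣≡1+k (cong suc (≤-antisym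
    (≤-pred (subst (_≤ suc n) ∣S₂∣≡1+k (∣p∣≤n S₂))) (≤-pred (≰⇒> 1+k≰n)))))
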